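{- Let $m,n$ be positive integers, $N=mn$, $g_{m,n}=m\binom{n}{2}-n+1$, and \[ \mathcal{D}_{m,n}=\Big\{(x_1,\dots,x_n)\in\mathbb{Z}^n : 0\le x_i\le N-1,\ \sum_{i=1}^n x_i\equiv g_{m,n}\pmod N\Big\}. \] Define $\mathrm{shift}(x_1,\dots,x_n)=(x_1+m,\dots,x_n+m)$ with each entry reduced modulo $N$ into $\{0,\dots,N-1\}$; this maps $\mathcal{D}_{m,n}$ to itself, and call two elements of $\mathcal{D}_{m,n}$ shift-equivalent if one is obtained from the other by applying $\mathrm{shift}^j$ for some $j\in\mathbb{N}$. For $\mathbf a=(a_1,\dots,a_n)$ let $\pi(\mathbf a)=(a_1,\dots,a_{n-1})$. Then every shift-equivalence class $\mathcal{C}\subseteq\mathcal{D}_{m,n}$ contains a unique element $\mathbf a\in\mathcal{C}$ such that $\pi(\mathbf a)\in\mathrm{Park}_{m,n}$.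
   Context: $\mathrm{Park}_{m,n}$ (the set of $K_n^m$-parking functions) is the set of sequences $(d_1,\dots,d_{n-1})$ of nonnegative integers whose weakly increasing rearrangement $(\tilde d_1\le\cdots\le\tilde d_{n-1})$ satisfies $\tilde d_i\le mi-1$ for all $1\le i\le n-1$; equivalently, for each $1\le i\le n-1$ there are at least $i$ entries that are $\le mi-1$. -}

module Defs where

open import Data.Nat using (ℕ; zero; suc; _+_; _*_; _∸_; _<_; _≤_; NonZero)
open import Data.Nat.DivMod using (_%_)
open import Data.Nat.Combinatorics using (_C_)
open import Data.Nat.Properties using (≤-totalOrder)
open import Data.Fin using (Fin; toℕ)
open import Data.Vec using (Vec; map; sum; toList; init; _∷ʳ_)
open import Data.Vec.Relation.Unary.All using (All)
open import Data.List using (List; length; lookup)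
open import Data.List.Relation.Binary.Permutation.Propositional using (_↭_)
open import Data.List.Relation.Unary.Sorted.TotalOrder ≤-totalOrder using (Sorted)
open import Data.Product using (Σ; ∃; _×_)
open import Data.Sum using (_⊎_)
open import Relation.Binary.PropositionalEquality using (_≡_)

-- g_{m,n} = m * C(n,2) - n + 1  (nonnegative for m,n ≥ 1, so ℕ-subtraction is exact)
g : ℕ → ℕ → ℕ
g m n = m * (n C 2) + 1 ∸ n

InD : (m n : ℕ) .{{_ : NonZero (m * n)}} → Vec ℕ n → Set
InD m n x = All (λ xi → xi < m * n) x × (sum x % (m * n) ≡ g m n % (m * n))

shift : (m n : ℕ) .{{_ : NonZero (m * n)}} → Vec ℕ n → Vec ℕ n
shift m n = map (λ xi → (xi + m) % (m * n))

iter : {A : Set} → ℕ → (A → A) → A → A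
iter zero    f a = a
iter (suc j) f a = f (iter j f a)

ShiftEquiv : (m n : ℕ) .{{_ : NonZero (m * n)}} → Vec ℕ n → Vec ℕ n → Set
ShiftEquiv m n a b =
  (∃ λ j → iter j (shift m n) a ≡ b) ⊎ (∃ λ j → iter j (shift m n) b ≡ a)

-- K_n^m-parking functions: the weakly increasing rearrangement s of d
-- satisfies s_i ≤ m i - 1 (1-indexed i), i.e. s_i < m i.
Park : (m : ℕ) {k : ℕ} → Vec ℕ k → Set
Park m d = Σ (List ℕ) λ s →
  (s ↭ toList d) × Sorted s ×
  ((i : Fin (length s)) → lookup s i < m * suc (toℕ i))

π : {k : ℕ} → Vec ℕ (suc k) → Vec ℕ k
π = init

-- Shifting j times adds m j to every coordinate modulo N.  Let F t count the coordinates of π c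
-- below m t and put r = n − j.  The rotation by m j moves the coordinates below m r up by m j and
-- the others down by m r, so afterwards the number below m t is F (r + t) − F r for t ≤ j and
-- F s + n − 1 − F r for t = s + j.  Hence π (shiftʲ c) is a parking function exactly when r is the
-- first point of [0, n] at which F t − t is minimal.  Such a point exists and is unique, and since
-- n shifts are the identity, the class of c consists of the shiftʲ c with j < n.

module Submission where

open import Defs
open import Data.Nat using (ℕ; zero; suc; _+_; _*_; _∸_; _<_; _≤_; z≤n; s≤s; NonZero; _<?_; _≤?_)
open import Data.Nat.Properties
open import Algebra.Properties.CommutativeSemigroup +-commutativeSemigroup using (interchange; xy∙z≈yz∙x; xy∙z≈xz∙y; xy∙z≈zx∙y)
open import Data.Nat.DivMod using (_%_; _/_; %-distribˡ-+; m%n%n≡m%n; [m+n]%n≡m%n; [m+kn]%n≡m%n; m<n⇒m%n≡m; m%n<n; m≡m%n+[m/n]*n)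
open import Data.Nat.ListAction using (sum)
open import Data.Nat.ListAction.Properties using (sum-↭)
open import Data.Nat.Tactic.RingSolver using (solve-∀)
open import Data.Fin using (Fin; toℕ; fromℕ<) renaming (zero to fzero; suc to fsuc)
open import Data.Fin.Properties using (toℕ-fromℕ<; toℕ<n)
open import Data.List as List using (List; []; _∷_; length; lookup)
import Data.List.Properties as List
open import Data.List.Membership.Propositional.Properties using (∈-lookup)
open import Data.List.Relation.Unary.All as ListAll using ([]; _∷_)
open import Data.List.Relation.Unary.AllPairs using (AllPairs; []; _∷_)
open import Data.List.Relation.Unary.Linked.Properties using (Linked⇒AllPairs)
open import Data.List.Relation.Binary.Permutation.Propositional using (_↭_)
open import Data.List.Relation.Binary.Permutation.Propositional.Properties using (↭-length; map⁺)
import Data.List.Sort ≤-decTotalOrder as Sort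
open import Data.List.Relation.Unary.Sorted.TotalOrder ≤-totalOrder using (Sorted)
open import Data.Vec as Vec using (Vec; []; _∷_; map; toList; init)
open import Data.Vec.Properties using (map-∘; map-cong; length-toList; toList-map)
open import Data.Vec.Relation.Unary.All using (All; []; _∷_; universal)
import Data.Vec.Relation.Unary.All as All
import Data.Vec.Relation.Unary.All.Properties as All
open import Data.Product using (Σ; ∃; _×_; _,_; proj₁; proj₂)
open import Data.Sum using (_⊎_; inj₁; inj₂)
open import Relation.Nullary using (Dec; yes; no; ¬_; contradiction)
open import Relation.Binary.PropositionalEquality using (_≡_; refl; sym; trans; cong; cong₂; subst; subst₂; module ≡-Reasoning)

module _ {d : ℕ} .{{_ : NonZero d}} where

  %-absorbˡ : ∀ a b → (a % d + b) % d ≡ (a + b) % d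
  %-absorbˡ a b = begin
    (a % d + b) % d           ≡⟨ %-distribˡ-+ (a % d) b d ⟩
    (a % d % d + b % d) % d   ≡⟨ cong (λ x → (x + b % d) % d) (m%n%n≡m%n a d) ⟩
    (a % d + b % d) % d       ≡⟨ %-distribˡ-+ a b d ⟨
    (a + b) % d               ∎
    where open ≡-Reasoning

  %-absorbʳ : ∀ a b → (a + b % d) % d ≡ (a + b) % d
  %-absorbʳ a b = begin
    (a + b % d) % d   ≡⟨ cong (_% d) (+-comm a (b % d)) ⟩
    (b % d + a) % d   ≡⟨ %-absorbˡ b a ⟩
    (b + a) % d       ≡⟨ cong (_% d) (+-comm b a) ⟩
    (a + b) % d       ∎
    where open ≡-Reasoning

below-or-above : ∀ a x → x < a ⊎ ∃ λ y → a + y ≡ x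
below-or-above a x with a ≤? x
... | yes a≤x = inj₂ (m≤n⇒∃[o]m+o≡n a≤x)
... | no a≰x  = inj₁ (≰⇒> a≰x)

+-assoc-middle : ∀ a b c d → a + b + (c + d) ≡ a + (b + c) + d
+-assoc-middle a b c d = trans (sym (+-assoc (a + b) c d)) (cong (_+ d) (+-assoc a b c))

+-∸-cross : ∀ {A B a b n} → a ≤ n → b ≤ n → A + (n ∸ a) ≤ B + (n ∸ b) → A + b ≤ B + a
+-∸-cross {A} {B} {a} {b} {n} a≤n b≤n le = +-cancelʳ-≤ n (A + b) (B + a) (begin
  A + b + n               ≡⟨ cong (A + b +_) (m∸n+n≡m a≤n) ⟨
  A + b + (n ∸ a + a)     ≡⟨ regroup A b (n ∸ a) a ⟩
  A + (n ∸ a) + (a + b)   ≤⟨ +-monoˡ-≤ (a + b) le ⟩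
  B + (n ∸ b) + (a + b)   ≡⟨ regroup′ B (n ∸ b) a b ⟩
  B + a + (n ∸ b + b)     ≡⟨ cong (B + a +_) (m∸n+n≡m b≤n) ⟩
  B + a + n               ∎)
  where
  open ≤-Reasoning
  regroup : ∀ A b x a → A + b + (x + a) ≡ A + x + (a + b)
  regroup = solve-∀
  regroup′ : ∀ B y a b → B + y + (a + b) ≡ B + a + (y + b)
  regroup′ = solve-∀

iter-+ : ∀ {A : Set} (f : A → A) i j x → iter (i + j) f x ≡ iter i f (iter j f x)
iter-+ f zero    j x = refl
iter-+ f (suc i) j x = cong f (iter-+ f i j x)

map-fixed : ∀ {A : Set} {l} {f : A → A} {v : Vec A l} → All (λ x → f x ≡ x) v → map f v ≡ v
map-fixed []             = refl
map-fixed (fx≡x ∷ fv≡v) = cong₂ _∷_ fx≡x (map-fixed fv≡v)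

init-map : ∀ {A B : Set} {k} (f : A → B) (v : Vec A (suc k)) → init (map f v) ≡ map f (init v)
init-map {k = zero}  f (x ∷ [])     = refl
init-map {k = suc k} f (x ∷ y ∷ v) = cong (f x ∷_) (init-map f (y ∷ v))

All-init : ∀ {A : Set} {P : A → Set} {k} {v : Vec A (suc k)} → All P v → All P (init v)
All-init {k = zero}  (px ∷ [])        = []
All-init {k = suc k} (px ∷ py ∷ pv) = px ∷ All-init (py ∷ pv)

𝟙 : ∀ {p} {P : Set p} → Dec P → ℕ
𝟙 (yes _) = 1
𝟙 (no _)  = 0

module _ {p} {P : Set p} where

  𝟙-yes : (P? : Dec P) → P → 𝟙 P? ≡ 1
  𝟙-yes (yes _) _  = refl
  𝟙-yes (no ¬p) p′ = contradiction p′ ¬p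

  𝟙-no : (P? : Dec P) → ¬ P → 𝟙 P? ≡ 0
  𝟙-no (yes p′) ¬p = contradiction p′ ¬p
  𝟙-no (no _)   _  = refl

𝟙-cong : ∀ {p q} {P : Set p} {Q : Set q} (P? : Dec P) (Q? : Dec Q) →
         (P → Q) → (Q → P) → 𝟙 P? ≡ 𝟙 Q?
𝟙-cong (yes _) (yes _) _   _   = refl
𝟙-cong (yes p) (no ¬q) P→Q _   = contradiction (P→Q p) ¬q
𝟙-cong (no ¬p) (yes q) _   Q→P = contradiction (Q→P q) ¬p
𝟙-cong (no _)  (no _)  _   _   = refl

countBelow : ℕ → List ℕ → ℕ
countBelow x ys = sum (List.map (λ y → 𝟙 (y <? x)) ys)

countBelow-↭ : ∀ x {ys zs} → ys ↭ zs → countBelow x ys ≡ countBelow x zs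
countBelow-↭ x p = sum-↭ (map⁺ _ p)

countBelow-none : ∀ {x ys} → ListAll.All (x ≤_) ys → countBelow x ys ≡ 0
countBelow-none []                 = refl
countBelow-none {x} (x≤y ∷ x≤ys) = cong₂ _+_ (𝟙-no (_ <? x) (≤⇒≯ x≤y)) (countBelow-none x≤ys)

countBelow-map : ∀ x (f : ℕ → ℕ) ys → countBelow x (List.map f ys) ≡ sum (List.map (λ y → 𝟙 (f y <? x)) ys)
countBelow-map x f ys = cong sum (sym (List.map-∘ ys))

sum-map-pointwise : ∀ {P : ℕ → Set} {f g h : ℕ → ℕ} {e xs} → (∀ {x} → P x → f x + g x ≡ h x + e) →
                    ListAll.All P xs →
                    sum (List.map f xs) + sum (List.map g xs) ≡ sum (List.map h xs) + length xs * e
sum-map-pointwise eq []                = refl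
sum-map-pointwise {f = f} {g} {h} {e} {x ∷ xs} eq (px ∷ pxs) = begin
  (f x + Σf) + (g x + Σg)             ≡⟨ interchange (f x) Σf (g x) Σg ⟩
  (f x + g x) + (Σf + Σg)             ≡⟨ cong₂ _+_ (eq px) (sum-map-pointwise eq pxs) ⟩
  (h x + e) + (Σh + length xs * e)    ≡⟨ interchange (h x) e Σh (length xs * e) ⟩
  (h x + Σh) + (e + length xs * e)    ∎
  where
  open ≡-Reasoning
  Σf Σg Σh : ℕ
  Σf = sum (List.map f xs)
  Σg = sum (List.map g xs)
  Σh = sum (List.map h xs)

sorted-lookup<⇒ : ∀ {x ys} → AllPairs _≤_ ys → (i : Fin (length ys)) →
                  lookup ys i < x → suc (toℕ i) ≤ countBelow x ys
sorted-lookup<⇒ {x} {y ∷ ys} (y≤ys ∷ ys↗) i yᵢ<x with y <? x | i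
... | yes _   | fzero   = s≤s z≤n
... | yes _   | fsuc i′ = s≤s (sorted-lookup<⇒ ys↗ i′ yᵢ<x)
... | no y≮x | fzero   = contradiction yᵢ<x y≮x
... | no y≮x | fsuc i′ = contradiction (≤-<-trans (ListAll.lookup y≤ys (∈-lookup i′)) yᵢ<x) y≮x

sorted-lookup<⇐ : ∀ {x ys} → AllPairs _≤_ ys → (i : Fin (length ys)) →
                  suc (toℕ i) ≤ countBelow x ys → lookup ys i < x
sorted-lookup<⇐ {x} {y ∷ ys} (y≤ys ∷ ys↗) i i<count with y <? x | i
... | yes y<x | fzero   = y<x
... | yes _   | fsuc i′ = sorted-lookup<⇐ ys↗ i′ (≤-pred i<count)
... | no y≮x | _       = contradiction (subst (_ ≤_) (countBelow-none x≤ys) i<count) λ ()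
  where
  x≤ys : ListAll.All (x ≤_) ys
  x≤ys = ListAll.map (≤-trans (≮⇒≥ y≮x)) y≤ys

CountParking : (m : ℕ) {k : ℕ} → Vec ℕ k → Set
CountParking m {k} d = ∀ t → t < k → suc t ≤ countBelow (m * suc t) (toList d)

park⇒countParking : ∀ m {k} (d : Vec ℕ k) → Park m d → CountParking m d
park⇒countParking m d (s , s↭d , s↗ , s<) t t<k =
  subst (suc t ≤_) (countBelow-↭ (m * suc t) s↭d)
    (subst (λ i → suc i ≤ countBelow (m * suc i) s) (toℕ-fromℕ< t<∣s∣)
      (sorted-lookup<⇒ (Linked⇒AllPairs ≤-trans s↗) (fromℕ< t<∣s∣) (s< (fromℕ< t<∣s∣))))
  where
  t<∣s∣ : t < length s
  t<∣s∣ = subst (t <_) (sym (trans (↭-length s↭d) (length-toList d))) t<k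

countParking⇒park : ∀ m {k} (d : Vec ℕ k) → CountParking m d → Park m d
countParking⇒park m {k} d d-parks = s , Sort.sort-↭ (toList d) , s↗ , λ i →
  sorted-lookup<⇐ (Linked⇒AllPairs ≤-trans s↗) i
    (subst (suc (toℕ i) ≤_) (sym (countBelow-↭ _ (Sort.sort-↭ (toList d))))
      (d-parks (toℕ i) (subst (toℕ i <_) ∣s∣≡k (toℕ<n i))))
  where
  s : List ℕ
  s = Sort.sort (toList d)
  s↗ : Sorted s
  s↗ = Sort.sort-↗ (toList d)
  ∣s∣≡k : length s ≡ k
  ∣s∣≡k = trans (↭-length (Sort.sort-↭ (toList d))) (length-toList d)

firstArgmin : (Q : ℕ → ℕ) (n : ℕ) →
              ∃ λ r → r ≤ n × (∀ s → s < r → Q r < Q s) × (∀ s → s ≤ n → Q r ≤ Q s)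
firstArgmin Q zero = 0 , z≤n , (λ _ ()) , λ { .0 z≤n → ≤-refl }
firstArgmin Q (suc n) with firstArgmin Q n
... | r , r≤n , earlier , minimal with Q (suc n) <? Q r
...   | yes Q[1+n]<Qr = suc n , ≤-refl , (λ s s<1+n → <-≤-trans Q[1+n]<Qr (minimal s (≤-pred s<1+n))) , minimal′
  where
  minimal′ : ∀ s → s ≤ suc n → Q (suc n) ≤ Q s
  minimal′ s s≤1+n with m≤n⇒m<n∨m≡n s≤1+n
  ... | inj₁ s<1+n = <⇒≤ (<-≤-trans Q[1+n]<Qr (minimal s (≤-pred s<1+n)))
  ... | inj₂ refl  = ≤-refl
...   | no Q[1+n]≮Qr = r , m≤n⇒m≤1+n r≤n , earlier , minimal′
  where
  minimal′ : ∀ s → s ≤ suc n → Q r ≤ Q s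
  minimal′ s s≤1+n with m≤n⇒m<n∨m≡n s≤1+n
  ... | inj₁ s<1+n = minimal s (≤-pred s<1+n)
  ... | inj₂ refl  = ≮⇒≥ Q[1+n]≮Qr

-- r is the first point of [0, n] at which t ↦ F t − t is minimal
-- (the differences are compared crosswise to avoid truncated subtraction).
record IsFirstMin (F : ℕ → ℕ) (n r : ℕ) : Set where
  field
    bounded : r ≤ n
    earlier : ∀ s → s < r → F r + s < F s + r
    later   : ∀ t → r ≤ t → t ≤ n → F r + t ≤ F t + r

open IsFirstMin

firstMin-≮ : ∀ {F n r₁ r₂} → IsFirstMin F n r₁ → IsFirstMin F n r₂ → ¬ r₁ < r₂
firstMin-≮ min₁ min₂ r₁<r₂ =
  <⇒≱ (earlier min₂ _ r₁<r₂) (later min₁ _ (<⇒≤ r₁<r₂) (bounded min₂))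

firstMin-unique : ∀ {F n r₁ r₂} → IsFirstMin F n r₁ → IsFirstMin F n r₂ → r₁ ≡ r₂
firstMin-unique min₁ min₂ = ≤-antisym (≮⇒≥ (firstMin-≮ min₂ min₁)) (≮⇒≥ (firstMin-≮ min₁ min₂))

firstMin-exists : ∀ F n → ∃ (IsFirstMin F n)
firstMin-exists F n with firstArgmin (λ s → F s + (n ∸ s)) n
... | r , r≤n , earlier′ , minimal = r , record
  { bounded = r≤n
  ; earlier = λ s s<r → +-∸-cross r≤n (≤-trans (<⇒≤ s<r) r≤n) (earlier′ s s<r)
  ; later   = λ t _ t≤n → +-∸-cross r≤n t≤n (minimal t t≤n)
  }

module _ (m k : ℕ) .{{_ : NonZero (m * suc k)}} where

  private
    n N : ℕ
    n = suc k
    N = m * n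

  rotate : ℕ → ℕ → ℕ
  rotate j x = (x + m * j) % N

  rotate-suc : ∀ j x → (rotate j x + m) % N ≡ rotate (suc j) x
  rotate-suc j x = trans (%-absorbˡ (x + m * j) m) (cong (_% N) (begin
    x + m * j + m     ≡⟨ +-assoc x (m * j) m ⟩
    x + (m * j + m)   ≡⟨ cong (x +_) (+-comm (m * j) m) ⟩
    x + (m + m * j)   ≡⟨ cong (x +_) (*-suc m j) ⟨
    x + m * suc j     ∎))
    where open ≡-Reasoning

  rotate-period : ∀ q {x} → x < N → rotate (q * n) x ≡ x
  rotate-period q {x} x<N = begin
    (x + m * (q * n)) % N   ≡⟨ cong (λ y → (x + y) % N) m*[q*n]≡q*[m*n] ⟩
    (x + q * N) % N         ≡⟨ [m+kn]%n≡m%n x q N ⟩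
    x % N                   ≡⟨ m<n⇒m%n≡m x<N ⟩
    x                       ∎
    where
    open ≡-Reasoning
    m*[q*n]≡q*[m*n] : m * (q * n) ≡ q * N
    m*[q*n]≡q*[m*n] = trans (sym (*-assoc m q n)) (trans (cong (_* n) (*-comm m q)) (*-assoc q m n))

  iterate-shift : ∀ j {v : Vec ℕ n} → All (_< N) v → iter j (shift m n) v ≡ map (rotate j) v
  iterate-shift zero    v<N = sym (map-fixed (All.map (rotate-period 0) v<N))
  iterate-shift (suc j) {v} v<N = begin
    shift m n (iter j (shift m n) v)              ≡⟨ cong (shift m n) (iterate-shift j v<N) ⟩
    map (λ y → (y + m) % N) (map (rotate j) v)    ≡⟨ map-∘ _ (rotate j) v ⟨
    map (λ x → (rotate j x + m) % N) v            ≡⟨ map-cong (rotate-suc j) v ⟩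
    map (rotate (suc j)) v                        ∎
    where open ≡-Reasoning

  iterate-shift-period : ∀ q {v : Vec ℕ n} → All (_< N) v → iter (q * n) (shift m n) v ≡ v
  iterate-shift-period q v<N = trans (iterate-shift (q * n) v<N) (map-fixed (All.map (rotate-period q) v<N))

  iterate-shift-mod : ∀ j {v : Vec ℕ n} → All (_< N) v → iter j (shift m n) v ≡ iter (j % n) (shift m n) v
  iterate-shift-mod j {v} v<N = begin
    iter j (shift m n) v
      ≡⟨ cong (λ i → iter i (shift m n) v) (m≡m%n+[m/n]*n j n) ⟩
    iter (j % n + j / n * n) (shift m n) v
      ≡⟨ iter-+ (shift m n) (j % n) (j / n * n) v ⟩
    iter (j % n) (shift m n) (iter (j / n * n) (shift m n) v)
      ≡⟨ cong (iter (j % n) (shift m n)) (iterate-shift-period (j / n) v<N) ⟩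
    iter (j % n) (shift m n) v
      ∎
    where open ≡-Reasoning

  -- Going back from b to c by j shifts is going forward by j k, since n shifts are the identity.
  shiftEquiv⇒iterate : ∀ {c b : Vec ℕ n} → All (_< N) b → ShiftEquiv m n c b →
                       ∃ λ j → iter j (shift m n) c ≡ b
  shiftEquiv⇒iterate b<N (inj₁ c→b) = c→b
  shiftEquiv⇒iterate {c} {b} b<N (inj₂ (j , b→c)) = j * k , (begin
    iter (j * k) (shift m n) c                          ≡⟨ cong (iter (j * k) (shift m n)) b→c ⟨
    iter (j * k) (shift m n) (iter j (shift m n) b)     ≡⟨ iter-+ (shift m n) (j * k) j b ⟨
    iter (j * k + j) (shift m n) b                      ≡⟨ cong (λ i → iter i (shift m n) b) j*k+j≡j*n ⟩
    iter (j * n) (shift m n) b                          ≡⟨ iterate-shift-period j b<N ⟩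
    b                                                   ∎)
    where
    open ≡-Reasoning
    j*k+j≡j*n : j * k + j ≡ j * n
    j*k+j≡j*n = trans (+-comm (j * k) j) (sym (*-suc j k))

  shiftEquiv⇒iterate<n : ∀ {c b : Vec ℕ n} → All (_< N) c → All (_< N) b → ShiftEquiv m n c b →
                         ∃ λ j → j < n × iter j (shift m n) c ≡ b
  shiftEquiv⇒iterate<n c<N b<N c~b with shiftEquiv⇒iterate b<N c~b
  ... | j , c→b = j % n , m%n<n j n , trans (sym (iterate-shift-mod j c<N)) c→b

  sum-shift : ∀ {l} (v : Vec ℕ l) → Vec.sum (map (λ y → (y + m) % N) v) % N ≡ (Vec.sum v + l * m) % N
  sum-shift [] = refl
  sum-shift {suc l} (y ∷ v) = begin
    ((y + m) % N + S′) % N                  ≡⟨ %-absorbˡ (y + m) S′ ⟩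
    (y + m + S′) % N                        ≡⟨ %-absorbʳ (y + m) S′ ⟨
    (y + m + S′ % N) % N                    ≡⟨ cong (λ z → (y + m + z) % N) (sum-shift v) ⟩
    (y + m + (Vec.sum v + l * m) % N) % N   ≡⟨ %-absorbʳ (y + m) (Vec.sum v + l * m) ⟩
    (y + m + (Vec.sum v + l * m)) % N       ≡⟨ cong (_% N) (regroup y m (Vec.sum v) l) ⟩
    (y + Vec.sum v + suc l * m) % N         ∎
    where
    open ≡-Reasoning
    S′ : ℕ
    S′ = Vec.sum (map (λ y → (y + m) % N) v)
    regroup : ∀ y m s l → y + m + (s + l * m) ≡ y + s + suc l * m
    regroup = solve-∀

  shift-InD : ∀ {v} → InD m n v → InD m n (shift m n v)
  shift-InD {v} (v<N , Σv≡g) = All.map⁺ (universal (λ y → m%n<n (y + m) N) v) , (begin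
    Vec.sum (shift m n v) % N    ≡⟨ sum-shift v ⟩
    (Vec.sum v + n * m) % N      ≡⟨ cong (λ z → (Vec.sum v + z) % N) (*-comm n m) ⟩
    (Vec.sum v + N) % N          ≡⟨ [m+n]%n≡m%n (Vec.sum v) N ⟩
    Vec.sum v % N                ≡⟨ Σv≡g ⟩
    g m n % N                    ∎)
    where open ≡-Reasoning

  iterate-InD : ∀ j {v} → InD m n v → InD m n (iter j (shift m n) v)
  iterate-InD zero    v∈D = v∈D
  iterate-InD (suc j) v∈D = shift-InD (iterate-InD j v∈D)

  π-iterate-shift : ∀ j {c : Vec ℕ n} → All (_< N) c → π (iter j (shift m n) c) ≡ map (rotate j) (π c)
  π-iterate-shift j {c} c<N = trans (cong init (iterate-shift j c<N)) (init-map (rotate j) c)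

  module _ {j r : ℕ} (j+r≡n : j + r ≡ n) where

    N≡m*r+m*j : N ≡ m * r + m * j
    N≡m*r+m*j = begin
      m * n             ≡⟨ cong (m *_) j+r≡n ⟨
      m * (j + r)       ≡⟨ *-distribˡ-+ m j r ⟩
      m * j + m * r     ≡⟨ +-comm (m * j) (m * r) ⟩
      m * r + m * j     ∎
      where open ≡-Reasoning

    rotate-low : ∀ {x} → x < m * r → rotate j x ≡ x + m * j
    rotate-low {x} x<mr = m<n⇒m%n≡m (subst (x + m * j <_) (sym N≡m*r+m*j) (+-monoˡ-< (m * j) x<mr))

    rotate-high : ∀ {y} → m * r + y < N → rotate j (m * r + y) ≡ y
    rotate-high {y} mr+y<N = begin
      (m * r + y + m * j) % N     ≡⟨ cong (λ z → (z + m * j) % N) (+-comm (m * r) y) ⟩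
      (y + m * r + m * j) % N     ≡⟨ cong (_% N) (+-assoc y (m * r) (m * j)) ⟩
      (y + (m * r + m * j)) % N   ≡⟨ cong (λ z → (y + z) % N) N≡m*r+m*j ⟨
      (y + N) % N                 ≡⟨ [m+n]%n≡m%n y N ⟩
      y % N                       ≡⟨ m<n⇒m%n≡m (≤-<-trans (m≤n+m y (m * r)) mr+y<N) ⟩
      y                           ∎
      where open ≡-Reasoning

    𝟙-rotate-low : ∀ {t x} → t ≤ j → x < N →
                   𝟙 (rotate j x <? m * t) + 𝟙 (x <? m * r) ≡ 𝟙 (x <? m * (r + t)) + 0
    𝟙-rotate-low {t} {x} t≤j x<N with below-or-above (m * r) x
    ... | inj₁ x<mr = trans (cong₂ _+_ (𝟙-no (_ <? _) (≤⇒≯ mt≤rotate)) (𝟙-yes (_ <? _) x<mr))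
                            (sym (cong (_+ 0) (𝟙-yes (_ <? _) (<-≤-trans x<mr (*-monoʳ-≤ m (m≤m+n r t))))))
      where
      mt≤rotate : m * t ≤ rotate j x
      mt≤rotate = ≤-trans (*-monoʳ-≤ m t≤j) (subst (m * j ≤_) (sym (rotate-low x<mr)) (m≤n+m (m * j) x))
    ... | inj₂ (y , refl) rewrite rotate-high x<N | *-distribˡ-+ m r t =
      cong₂ _+_ (𝟙-cong (_ <? _) (_ <? _) (+-monoʳ-< (m * r)) (+-cancelˡ-< (m * r) y (m * t)))
                (𝟙-no (_ <? _) (m+n≮m (m * r) y))

    𝟙-rotate-high : ∀ {s x} → s ≤ r → x < N →
                    𝟙 (rotate j x <? m * (s + j)) + 𝟙 (x <? m * r) ≡ 𝟙 (x <? m * s) + 1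
    𝟙-rotate-high {s} {x} s≤r x<N with below-or-above (m * r) x
    ... | inj₁ x<mr rewrite rotate-low x<mr | *-distribˡ-+ m s j =
      cong₂ _+_ (𝟙-cong (_ <? _) (_ <? _) (+-cancelʳ-< (m * j) x (m * s)) (+-monoˡ-< (m * j))) (𝟙-yes (_ <? _) x<mr)
    ... | inj₂ (y , refl) rewrite rotate-high x<N =
      trans (cong₂ _+_ (𝟙-yes (_ <? _) y<m[s+j]) (𝟙-no (_ <? _) (m+n≮m (m * r) y)))
            (cong (_+ 1) (sym (𝟙-no (_ <? _) (≤⇒≯ (≤-trans (*-monoʳ-≤ m s≤r) (m≤m+n (m * r) y))))))
      where
      y<m[s+j] : y < m * (s + j)
      y<m[s+j] = subst (y <_) (sym (*-distribˡ-+ m s j))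
        (<-≤-trans (+-cancelˡ-< (m * r) y (m * j) (subst (m * r + y <_) N≡m*r+m*j x<N)) (m≤n+m (m * j) (m * s)))

  module Counts (D : Vec ℕ k) (D<N : All (_< N) D) where

    F : ℕ → ℕ
    F t = countBelow (m * t) (toList D)

    F′ : ℕ → ℕ → ℕ
    F′ j t = countBelow (m * t) (toList (map (rotate j) D))

    private
      D<N′ : ListAll.All (_< N) (toList D)
      D<N′ = All.toList⁺ D<N

      F′-sum : ∀ j t → F′ j t ≡ sum (List.map (λ x → 𝟙 (rotate j x <? m * t)) (toList D))
      F′-sum j t = trans (cong (countBelow (m * t)) (toList-map (rotate j) D))
                         (countBelow-map (m * t) (rotate j) (toList D))

    F′-low : ∀ {j r t} → j + r ≡ n → t ≤ j → F′ j t + F r ≡ F (r + t)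
    F′-low {j} {r} {t} j+r≡n t≤j = begin
      F′ j t + F r                                ≡⟨ cong (_+ F r) (F′-sum j t) ⟩
      sum (List.map (λ x → 𝟙 (rotate j x <? m * t)) (toList D)) + F r
                                                  ≡⟨ sum-map-pointwise (𝟙-rotate-low j+r≡n t≤j) D<N′ ⟩
      F (r + t) + length (toList D) * 0           ≡⟨ cong (F (r + t) +_) (*-zeroʳ (length (toList D))) ⟩
      F (r + t) + 0                               ≡⟨ +-identityʳ (F (r + t)) ⟩
      F (r + t)                                   ∎
      where open ≡-Reasoning

    F′-high : ∀ {j r s} → j + r ≡ n → s ≤ r → F′ j (s + j) + F r ≡ F s + k
    F′-high {j} {r} {s} j+r≡n s≤r = begin
      F′ j (s + j) + F r                          ≡⟨ cong (_+ F r) (F′-sum j (s + j)) ⟩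
      sum (List.map (λ x → 𝟙 (rotate j x <? m * (s + j))) (toList D)) + F r
                                                  ≡⟨ sum-map-pointwise (𝟙-rotate-high j+r≡n s≤r) D<N′ ⟩
      F s + length (toList D) * 1                 ≡⟨ cong (F s +_) (trans (*-identityʳ _) (length-toList D)) ⟩
      F s + k                                     ∎
      where open ≡-Reasoning

    parks-≤ : ∀ {j} → CountParking m (map (rotate j) D) → ∀ {T} → T ≤ k → T ≤ F′ j T
    parks-≤ parks {zero}  _   = z≤n
    parks-≤ parks {suc t} t<k = parks t t<k

    firstMin⇒parks : ∀ {j r} → j + r ≡ n → IsFirstMin F n r → CountParking m (map (rotate j) D)
    firstMin⇒parks {j} {r} j+r≡n min t t<k with suc t ≤? j
    ... | yes T≤j = +-cancelˡ-≤ (F r + r) (suc t) (F′ j (suc t)) (begin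
      F r + r + suc t           ≡⟨ +-assoc (F r) r (suc t) ⟩
      F r + (r + suc t)         ≤⟨ later min (r + suc t) (m≤m+n r (suc t)) r+T≤n ⟩
      F (r + suc t) + r         ≡⟨ cong (_+ r) (F′-low j+r≡n T≤j) ⟨
      F′ j (suc t) + F r + r    ≡⟨ xy∙z≈yz∙x (F′ j (suc t)) (F r) r ⟩
      F r + r + F′ j (suc t)    ∎)
      where
      open ≤-Reasoning
      r+T≤n : r + suc t ≤ n
      r+T≤n = subst (r + suc t ≤_) (trans (+-comm r j) j+r≡n) (+-monoʳ-≤ r T≤j)
    ... | no T≰j = subst (λ T → T ≤ F′ j T) s+j≡T (+-cancelˡ-≤ (F r) (s + j) (F′ j (s + j))
                     (+-cancelʳ-≤ r (F r + (s + j)) (F r + F′ j (s + j)) (begin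
      F r + (s + j) + r         ≡⟨ +-assoc-middle (F r) s j r ⟨
      F r + s + (j + r)         ≡⟨ cong (F r + s +_) j+r≡n ⟩
      F r + s + suc k           ≡⟨ +-suc (F r + s) k ⟩
      suc (F r + s) + k         ≤⟨ +-monoˡ-≤ k (earlier min s s<r) ⟩
      F s + r + k               ≡⟨ xy∙z≈xz∙y (F s) r k ⟩
      F s + k + r               ≡⟨ cong (_+ r) (F′-high j+r≡n (<⇒≤ s<r)) ⟨
      F′ j (s + j) + F r + r    ≡⟨ cong (_+ r) (+-comm (F′ j (s + j)) (F r)) ⟩
      F r + F′ j (s + j) + r    ∎)))
      where
      open ≤-Reasoning
      s : ℕ
      s = suc t ∸ j
      s+j≡T : s + j ≡ suc t
      s+j≡T = m∸n+n≡m (<⇒≤ (≰⇒> T≰j))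
      s<r : s < r
      s<r = +-cancelʳ-< j s r (subst₂ _<_ (sym s+j≡T) (trans (sym j+r≡n) (+-comm j r)) (s≤s t<k))

    parks⇒firstMin : ∀ {j r} → j + r ≡ n → j < n → CountParking m (map (rotate j) D) → IsFirstMin F n r
    parks⇒firstMin {j} {r} j+r≡n j<n parks = record
      { bounded = subst (r ≤_) j+r≡n (m≤n+m r j)
      ; earlier = earlier′
      ; later   = later′
      }
      where
      j≤k : j ≤ k
      j≤k = ≤-pred j<n

      earlier′ : ∀ s → s < r → F r + s < F s + r
      earlier′ s s<r = +-cancelʳ-≤ k (suc (F r + s)) (F s + r) (begin
        suc (F r + s) + k         ≡⟨ +-suc (F r + s) k ⟨
        F r + s + suc k           ≡⟨ cong (F r + s +_) j+r≡n ⟨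
        F r + s + (j + r)         ≡⟨ +-assoc-middle (F r) s j r ⟩
        F r + (s + j) + r         ≤⟨ +-monoˡ-≤ r (+-monoʳ-≤ (F r) (parks-≤ parks s+j≤k)) ⟩
        F r + F′ j (s + j) + r    ≡⟨ cong (_+ r) (+-comm (F r) (F′ j (s + j))) ⟩
        F′ j (s + j) + F r + r    ≡⟨ cong (_+ r) (F′-high j+r≡n (<⇒≤ s<r)) ⟩
        F s + k + r               ≡⟨ xy∙z≈xz∙y (F s) k r ⟩
        F s + r + k               ∎)
        where
        open ≤-Reasoning
        s+j≤k : s + j ≤ k
        s+j≤k = ≤-pred (subst (s + j <_) (trans (+-comm r j) j+r≡n) (+-monoˡ-< j s<r))

      later′ : ∀ t → r ≤ t → t ≤ n → F r + t ≤ F t + r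
      later′ t r≤t t≤n with m≤n⇒∃[o]m+o≡n r≤t
      ... | T , refl = begin
        F r + (r + T)             ≡⟨ +-assoc (F r) r T ⟨
        F r + r + T               ≤⟨ +-monoʳ-≤ (F r + r) (parks-≤ parks (≤-trans T≤j j≤k)) ⟩
        F r + r + F′ j T          ≡⟨ xy∙z≈zx∙y (F r) r (F′ j T) ⟩
        F′ j T + F r + r          ≡⟨ cong (_+ r) (F′-low j+r≡n T≤j) ⟩
        F (r + T) + r             ∎
        where
        open ≤-Reasoning
        T≤j : T ≤ j
        T≤j = +-cancelˡ-≤ r T j (subst (r + T ≤_) (trans (sym j+r≡n) (+-comm j r)) t≤n)

proposition3p3 : (m k : ℕ) → .{{_ : NonZero (m * suc k)}} →
    (c : Vec ℕ (suc k)) → InD m (suc k) c →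
    Σ (Vec ℕ (suc k)) λ a →
      (InD m (suc k) a × ShiftEquiv m (suc k) c a × Park m (π a)) ×
      ((b : Vec ℕ (suc k)) → InD m (suc k) b → ShiftEquiv m (suc k) c b →
        Park m (π b) → b ≡ a)
proposition3p3 m k c c∈D = a , (iterate-InD m k j c∈D , inj₁ (j , refl) , a-parks) , unique
  where
  c<N : All (_< m * suc k) c
  c<N = proj₁ c∈D
  open Counts m k (π c) (All-init c<N)
  r : ℕ
  r = proj₁ (firstMin-exists F (suc k))
  r-min : IsFirstMin F (suc k) r
  r-min = proj₂ (firstMin-exists F (suc k))
  j : ℕ
  j = suc k ∸ r
  j+r≡n : j + r ≡ suc k
  j+r≡n = m∸n+n≡m (bounded r-min)
  a : Vec ℕ (suc k)
  a = iter j (shift m (suc k)) c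
  a-parks : Park m (π a)
  a-parks = subst (Park m) (sym (π-iterate-shift m k j c<N))
                  (countParking⇒park m _ (firstMin⇒parks j+r≡n r-min))
  unique : (b : Vec ℕ (suc k)) → InD m (suc k) b → ShiftEquiv m (suc k) c b → Park m (π b) → b ≡ a
  unique b (b<N , _) c~b b-parks with shiftEquiv⇒iterate<n m k c<N b<N c~b
  ... | i , i<n , refl = cong (λ i → iter i (shift m (suc k)) c) (+-cancelʳ-≡ r i j (begin
    i + r                 ≡⟨ cong (i +_) (firstMin-unique r′-min r-min) ⟨
    i + (suc k ∸ i)       ≡⟨ m+[n∸m]≡n (<⇒≤ i<n) ⟩
    suc k                 ≡⟨ j+r≡n ⟨
    j + r                 ∎))
    where
    open ≡-Reasoning
    r′-min : IsFirstMin F (suc k) (suc k ∸ i)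
    r′-min = parks⇒firstMin (m+[n∸m]≡n (<⇒≤ i<n)) i<n
      (park⇒countParking m _ (subst (Park m) (π-iterate-shift m k i c<N) b-parks))
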